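{- Let $n\ge 2$, let $\ell\ne 1$ be a positive divisor of $n-1$, and let $k\ne 1$ be a positive divisor of $n$. Fix integers $0\le i\le k-1$ and $0\le j\le \ell-1$. Then the number of permutations $\sigma\in S_n$ with $\operatorname{maj}(\sigma)\equiv i\pmod k$ and $\operatorname{maj}(\sigma^{ -1})\equiv j\pmod \ell$ equals $\dfrac{n!}{k\cdot \ell}$.
   Context: $S_n$ is the symmetric group on $\{1,\ldots,n\}$. For $\sigma\in S_n$ and $1\le i\le n-1$, $i$ is a descent of $\sigma$ if $\sigma(i)>\sigma(i+1)$; the major index $\operatorname{maj}(\sigma)$ is the sum of the descents of $\sigma$. $\sigma^{ -1}$ is the inverse permutation. -}

module Defs where

open import Data.Bool using (Bool; true; false; not; _∨_; if_then_else_)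
open import Data.Nat using (ℕ; zero; suc; _+_; _<ᵇ_; _≡ᵇ_)
open import Data.Fin using (Fin; toℕ; zero; suc; inject₁)
open import Data.List using (List; []; _∷_; map; concatMap; length; filterᵇ; allFin)
open import Data.Bool.ListAction using (and)
open import Data.Nat.ListAction using (sum)
open import Data.Vec using (Vec; []; _∷_; lookup; tabulate)

-- Permutations of {1,…,n} are encoded 0-based on Fin n, in one-line
-- notation: σ is the vector (σ(0), …, σ(n-1)).

allVecs : (m n : ℕ) → List (Vec (Fin n) m)
allVecs zero    n = [] ∷ []
allVecs (suc m) n = concatMap (λ x → map (x ∷_) (allVecs m n)) (allFin n)

_=ᶠ_ : ∀ {n} → Fin n → Fin n → Bool
a =ᶠ b = toℕ a ≡ᵇ toℕ b

isPerm : ∀ {n} → Vec (Fin n) n → Bool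
isPerm {n} v =
  and (map (λ a → and (map (λ b → not (lookup v a =ᶠ lookup v b) ∨ (a =ᶠ b)) (allFin n))) (allFin n))

S : (n : ℕ) → List (Vec (Fin n) n)
S n = filterᵇ isPerm (allVecs n n)

-- Major index. With 0-based positions p, p+1 (both < n), position p is a
-- descent when σ(p) > σ(p+1); in 1-based terms this is the descent p+1,
-- which contributes p+1 to maj.

maj : ∀ {n} → Vec (Fin n) n → ℕ
maj {zero}  v = 0
maj {suc m} v =
  sum (map (λ (p : Fin m) →
         if toℕ (lookup v (suc p)) <ᵇ toℕ (lookup v (inject₁ p))
         then suc (toℕ p) else 0)
       (allFin m))

-- Inverse permutation: σ⁻¹(j) is the position i with σ(i) = j, found by
-- scanning the positions in order. (For a permutation such i exists and is
-- unique; the default 'd' is never used then.)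
findPos : ∀ {n} → Vec (Fin n) n → Fin n → List (Fin n) → Fin n → Fin n
findPos v j []       d = d
findPos v j (i ∷ is) d = if lookup v i =ᶠ j then i else findPos v j is d

inverse : ∀ {n} → Vec (Fin n) n → Vec (Fin n) n
inverse {n} v = tabulate (λ j → findPos v j (allFin n) j)

-- Write σ ∈ S (m + 1) as extend π x: the word of π ∈ S m with its values ≥ x raised by one,
-- followed by x. Appending x adds either 0 or m to maj, while σ⁻¹ is π⁻¹ with the new largest
-- letter m inserted at position x, and inserting a largest letter into the m + 1 slots of a word
-- raises its maj by 0, 1, …, m in some order. So if ℓ ∣ m then maj σ ≡ maj π mod ℓ, and if
-- k ∣ m + 1 then for fixed π every residue of maj σ⁻¹ mod k is attained by exactly (m + 1)/k of
-- the x. After exchanging σ and σ⁻¹ the count becomes (n/k) · #{π ∈ S (n - 1) : maj π ≡ j mod ℓ},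
-- and the same argument once more gives #{π ∈ S (n - 1) : maj π ≡ j mod ℓ} = ((n - 1)/ℓ) · (n - 2)!.
module Submission where

open import Defs
open import Data.Nat using (ℕ; _≤_; _<_; _*_; _∸_; _%_; _!; _≡ᵇ_; NonZero)
open import Data.Nat.Divisibility using (_∣_)
open import Data.List using (length; filterᵇ)
open import Data.Bool using (_∧_)
open import Relation.Binary.PropositionalEquality using (_≡_; _≢_)

open import Level using (Level)
open import Function using (_∘_; id; _⇔_; mk⇔; Equivalence)
open import Function.Definitions using (Injective)
open import Relation.Binary.PropositionalEquality
  using (refl; sym; trans; cong; cong₂; subst; module ≡-Reasoning)
open import Relation.Nullary using (yes; no; contradiction)
open import Relation.Nullary.Reflects using (Reflects; ofʸ; ofⁿ; fromEquivalence)
open import Data.Empty using (⊥-elim)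
open import Data.Unit using (tt)
open import Data.Product using (∃; ∃₂; _×_; _,_; proj₂)
open import Data.Sum using (_⊎_; inj₁; inj₂)
open import Data.Bool using (Bool; true; false; not; _∨_; if_then_else_; T; T?)
open import Data.Nat using (zero; suc; _+_; _<ᵇ_; z≤n; s≤s)
open import Data.Nat.Properties
  using (+-identityʳ; +-suc; +-assoc; ≤-reflexive; +-comm; *-suc; *-zeroʳ; ≡ᵇ⇒≡; ≡⇒≡ᵇ; <ᵇ-reflects-<;
         ≤-refl; <⇒≤; <-irrefl; ≤∧≢⇒<; m<n⇒m<1+n; n<1+n; m<m+n; ≰⇒>; <⇒≱; 1+n≰n)
open import Data.Nat.DivMod using (m<n⇒m%n≡m; [m+n]%n≡m%n; [m+kn]%n≡m%n)
open import Data.Nat.Divisibility using (divides)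
open import Data.Nat.ListAction using (sum)
open import Data.Bool.ListAction using (all)
open import Data.Nat.Tactic.RingSolver using (solve-∀)
open import Data.Fin as Fin using (Fin; toℕ; inject₁; fromℕ; punchIn; punchOut)
open import Data.Fin.Properties
  using (toℕ-injective; toℕ<n; toℕ-fromℕ; toℕ-inject₁; inject₁-injective; fromℕ≢inject₁;
         any?; injective⇒≤; punchIn-injective; punchInᵢ≢i; punchIn-punchOut; punchOut-injective;
         punchIn-mono-≤; punchIn-cancel-≤)
  renaming (_≟_ to _≟ᶠ_)
open import Data.Vec as Vec using (Vec; []; _∷_; lookup; tabulate; toList; insertAt; initLast)
open import Data.Vec.Properties
  using (lookup-map; lookup∘tabulate; tabulate∘lookup; tabulate-cong; ∷-injective; ∷ʳ-injective;
         map-∷ʳ; insertAt-lookup; insertAt-punchIn; toList-∷ʳ; toList-map; length-toList)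
  renaming (map-∘ to vmap-∘)
open import Data.List using (List; []; _∷_; [_]; _++_; _∷ʳ_; map; concatMap; allFin; cartesianProductWith)
  renaming (tabulate to tabulateᴸ)
open import Data.List.Properties
  using (length-++; filter-++; map-++; map-∘; map-id-local; map-cong-local; map-tabulate; length-tabulate)
  renaming (tabulate-cong to tabulateᴸ-cong)
open import Data.List.Reverse using (Reverse; reverseView; []; _∶_∶ʳ_)
open import Data.List.Membership.Propositional using (_∈_)
open import Data.List.Membership.Propositional.Properties
  using (∈-filter⁺; ∈-filter⁻; ∈-map⁺; ∈-map⁻; ∈-allFin; ∈-cartesianProductWith⁺; ∈-cartesianProductWith⁻)
open import Data.List.Membership.Propositional.Properties.WithK using (unique∧set⇒bag)
open import Data.List.Relation.Unary.Any using (here; there)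
open import Data.List.Relation.Unary.All as All using (All; []; _∷_)
open import Data.List.Relation.Unary.All.Properties using (all⁺; all⁻; tabulate⁺; tabulate⁻; ++⁻ˡ; ++⁻ʳ)
open import Data.List.Relation.Unary.Unique.Propositional using (Unique)
open import Data.List.Relation.Unary.AllPairs using ([]; _∷_)
open import Data.List.Relation.Unary.Unique.Propositional.Properties
  using (cartesianProductWith⁺; allFin⁺; filter⁺)
  renaming (map⁻ to Unique-map⁻)
open import Data.List.Relation.Binary.Permutation.Propositional
  using (_↭_; ↭-refl; ↭-sym; ↭-prep; module PermutationReasoning)
open import Data.List.Relation.Binary.Permutation.Propositional.Properties
  using (filter-↭; ↭-length; drop-∷; ∷↭∷ʳ; ++⁺ʳ) renaming (map⁺ to ↭-map⁺)
open import Data.List.Relation.Binary.BagAndSetEquality using (∼bag⇒↭)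

private
  variable
    ℓ₁ ℓ₂ ℓ₃ : Level
    A : Set ℓ₁
    B : Set ℓ₂
    C : Set ℓ₃
    m n : ℕ

count : (A → Bool) → List A → ℕ
count P xs = length (filterᵇ P xs)

count-true : (xs : List A) → count (λ _ → true) xs ≡ length xs
count-true []       = refl
count-true (x ∷ xs) = cong suc (count-true xs)

count-↭ : (P : A → Bool) {xs ys : List A} → xs ↭ ys → count P xs ≡ count P ys
count-↭ P xs↭ys = ↭-length (filter-↭ (T? ∘ P) xs↭ys)

count-++ : (P : A → Bool) (xs ys : List A) → count P (xs ++ ys) ≡ count P xs + count P ys
count-++ P xs ys = trans (cong length (filter-++ (T? ∘ P) xs ys)) (length-++ (filterᵇ P xs))

count-map : (P : B → Bool) (f : A → B) (xs : List A) → count P (map f xs) ≡ count (P ∘ f) xs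
count-map P f []       = refl
count-map P f (x ∷ xs) with P (f x)
... | true  = cong suc (count-map P f xs)
... | false = count-map P f xs

count-cong : {P Q : A → Bool} (xs : List A) → (∀ {x} → x ∈ xs → P x ≡ Q x) → count P xs ≡ count Q xs
count-cong                []       _   = refl
count-cong {P = P} {Q = Q} (x ∷ xs) P≡Q with P x | Q x | P≡Q (here refl)
... | true  | true  | refl = cong suc (count-cong xs (λ x∈xs → P≡Q (there x∈xs)))
... | false | false | refl = count-cong xs (λ x∈xs → P≡Q (there x∈xs))

count-∧-const : (P : A → Bool) (β : Bool) (xs : List A) →
                count (λ x → P x ∧ β) xs ≡ (if β then count P xs else 0)
count-∧-const P true  []       = refl
count-∧-const P false []       = refl
count-∧-const P β     (x ∷ xs) with P x | β | count-∧-const P β xs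
... | true  | true  | ih = cong suc ih
... | true  | false | ih = ih
... | false | true  | ih = ih
... | false | false | ih = ih

count-cartesianProductWith : (P : C → Bool) (f : A → B → C) (xs : List A) (ys : List B) →
                             count P (cartesianProductWith f xs ys) ≡ sum (map (λ x → count (P ∘ f x) ys) xs)
count-cartesianProductWith P f []       ys = refl
count-cartesianProductWith P f (x ∷ xs) ys =
  trans (count-++ P (map (f x) ys) _)
        (cong₂ _+_ (count-map P (f x) ys) (count-cartesianProductWith P f xs ys))

sum-map-if : (P : A → Bool) (q : ℕ) (xs : List A) → sum (map (λ x → if P x then q else 0) xs) ≡ q * count P xs
sum-map-if P q []       = sym (*-zeroʳ q)
sum-map-if P q (x ∷ xs) with P x
... | true  = trans (cong (q +_) (sum-map-if P q xs)) (sym (*-suc q _))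
... | false = sum-map-if P q xs

sum-map-const : (f : A → ℕ) {q : ℕ} (xs : List A) → (∀ {x} → x ∈ xs → f x ≡ q) → sum (map f xs) ≡ q * length xs
sum-map-const f {q} []       _    = sym (*-zeroʳ q)
sum-map-const f {q} (x ∷ xs) f≡q =
  trans (cong₂ _+_ (f≡q (here refl)) (sum-map-const f xs (λ x∈xs → f≡q (there x∈xs)))) (sym (*-suc q _))

unique∧set⇒↭ : {xs ys : List A} → Unique xs → Unique ys → (∀ {x} → x ∈ xs ⇔ x ∈ ys) → xs ↭ ys
unique∧set⇒↭ xs! ys! xs≈ys = ∼bag⇒↭ (unique∧set⇒bag xs! ys! xs≈ys)

map-involution-↭ : (f : A → A) {xs : List A} → Unique xs →
                   (∀ {x} → x ∈ xs → f x ∈ xs) → (∀ {x} → x ∈ xs → f (f x) ≡ x) → map f xs ↭ xs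
map-involution-↭ f {xs} xs! f-closed f-involutive = unique∧set⇒↭ fxs! xs! (mk⇔ to from)
  where
  ffxs≡xs : map f (map f xs) ≡ xs
  ffxs≡xs = trans (sym (map-∘ xs)) (map-id-local (All.tabulate f-involutive))
  fxs! : Unique (map f xs)
  fxs! = Unique-map⁻ (subst Unique (sym ffxs≡xs) xs!)
  to : ∀ {y} → y ∈ map f xs → y ∈ xs
  to y∈fxs with x , x∈xs , refl ← ∈-map⁻ f y∈fxs = f-closed x∈xs
  from : ∀ {y} → y ∈ xs → y ∈ map f xs
  from y∈xs = subst (_∈ map f xs) (f-involutive y∈xs) (∈-map⁺ f (f-closed y∈xs))

-- The permutations S n and their inverses

-- A record rather than a plain Injective so that σ can be inferred from a proof of IsPerm σ.
record IsPerm (σ : Vec (Fin n) n) : Set where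
  constructor injective⇒IsPerm
  field injective : Injective _≡_ _≡_ (lookup σ)
open IsPerm

T-=ᶠ : {x y : Fin n} → T (x =ᶠ y) ⇔ x ≡ y
T-=ᶠ {x = x} {y} = mk⇔ (toℕ-injective ∘ ≡ᵇ⇒≡ (toℕ x) (toℕ y)) (≡⇒≡ᵇ (toℕ x) (toℕ y) ∘ cong toℕ)

T-not-∨ : {x y : Bool} → T (not x ∨ y) ⇔ (T x → T y)
T-not-∨ {true}  = mk⇔ (λ ty _ → ty) (λ f → f tt)
T-not-∨ {false} = mk⇔ (λ _ ()) (λ _ → tt)

T-isPerm : (σ : Vec (Fin n) n) → T (isPerm σ) ⇔ IsPerm σ
T-isPerm {n} σ = mk⇔ to from
  where
  entry : Fin n → Fin n → Bool
  entry x y = not (lookup σ x =ᶠ lookup σ y) ∨ (x =ᶠ y)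
  to : T (isPerm σ) → IsPerm σ
  to t = injective⇒IsPerm λ {x} {y} σx≡σy →
    Equivalence.to T-=ᶠ (Equivalence.to T-not-∨
      (tabulate⁻ (all⁺ (entry x) _ (tabulate⁻ (all⁺ (λ x → all (entry x) (allFin n)) _ t) x)) y)
      (Equivalence.from T-=ᶠ σx≡σy))
  from : IsPerm σ → T (isPerm σ)
  from σ-perm =
    all⁻ (λ x → all (entry x) (allFin n)) (tabulate⁺ {f = id} λ x → all⁻ (entry x) (tabulate⁺ {f = id} λ y →
      Equivalence.from T-not-∨ (λ t → Equivalence.from T-=ᶠ (injective σ-perm (Equivalence.to T-=ᶠ t)))))

allVecs≡cartesianProductWith : ∀ m n → allVecs (suc m) n ≡ cartesianProductWith _∷_ (allFin n) (allVecs m n)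
allVecs≡cartesianProductWith m n = go (allFin n)
  where
  go : ∀ xs → concatMap (λ x → map (x ∷_) (allVecs m n)) xs ≡ cartesianProductWith _∷_ xs (allVecs m n)
  go []       = refl
  go (x ∷ xs) = cong (map (x ∷_) (allVecs m n) ++_) (go xs)

allVecs-unique : ∀ m n → Unique (allVecs m n)
allVecs-unique zero    n = [] ∷ []
allVecs-unique (suc m) n rewrite allVecs≡cartesianProductWith m n =
  cartesianProductWith⁺ _∷_ ∷-injective (allFin⁺ n) (allVecs-unique m n)

∈-allVecs : (v : Vec (Fin n) m) → v ∈ allVecs m n
∈-allVecs {n} {zero}  []      = here refl
∈-allVecs {n} {suc m} (x ∷ v) rewrite allVecs≡cartesianProductWith m n =
  ∈-cartesianProductWith⁺ _∷_ (∈-allFin x) (∈-allVecs v)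

S-unique : ∀ n → Unique (S n)
S-unique n = filter⁺ (T? ∘ isPerm) (allVecs-unique n n)

∈-S : {σ : Vec (Fin n) n} → σ ∈ S n ⇔ IsPerm σ
∈-S {n} {σ} = mk⇔ to from
  where
  to : σ ∈ S n → IsPerm σ
  to σ∈S = Equivalence.to (T-isPerm σ) (proj₂ (∈-filter⁻ (T? ∘ isPerm) {xs = allVecs n n} σ∈S))
  from : IsPerm σ → σ ∈ S n
  from σ-perm = ∈-filter⁺ (T? ∘ isPerm) (∈-allVecs σ) (Equivalence.from (T-isPerm σ) σ-perm)

lookup-ext : {u v : Vec A n} → (∀ i → lookup u i ≡ lookup v i) → u ≡ v
lookup-ext {u = u} {v} u≗v = trans (sym (tabulate∘lookup u)) (trans (tabulate-cong u≗v) (tabulate∘lookup v))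

findPos-correct : {σ : Vec (Fin n) n} → IsPerm σ → ∀ {i j} is d → i ∈ is → lookup σ i ≡ j → findPos σ j is d ≡ i
findPos-correct {σ = σ} σ-perm {i} {j} (i′ ∷ is) d i∈ σi≡j with lookup σ i′ =ᶠ j in eq
... | true = injective σ-perm (trans (Equivalence.to T-=ᶠ (subst T (sym eq) tt)) (sym σi≡j))
findPos-correct σ-perm (i′ ∷ is) d (here refl) σi≡j | false =
  ⊥-elim (subst T eq (Equivalence.from T-=ᶠ σi≡j))
findPos-correct σ-perm (i′ ∷ is) d (there i∈) σi≡j | false = findPos-correct σ-perm is d i∈ σi≡j

lookup-inverse : {σ : Vec (Fin n) n} → IsPerm σ → ∀ {i j} → lookup σ i ≡ j → lookup (inverse σ) j ≡ i
lookup-inverse {n} σ-perm {i} {j} σi≡j =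
  trans (lookup∘tabulate _ j) (findPos-correct σ-perm (allFin n) j (∈-allFin i) σi≡j)

-- Pigeonhole: if j were missed, punching it out would inject Fin (suc n) into Fin n.
IsPerm⇒surjective : {σ : Vec (Fin n) n} → IsPerm σ → ∀ j → ∃ λ i → lookup σ i ≡ j
IsPerm⇒surjective {suc n} {σ} σ-perm j with any? (λ i → lookup σ i ≟ᶠ j)
... | yes hit = hit
... | no  miss = contradiction (injective⇒≤ punchOut-injective′) 1+n≰n
  where
  j≢σ : ∀ i → j ≢ lookup σ i
  j≢σ i j≡σi = miss (i , sym j≡σi)
  punchOut-injective′ : Injective _≡_ _≡_ (λ i → punchOut (j≢σ i))
  punchOut-injective′ eq = injective σ-perm (punchOut-injective (j≢σ _) (j≢σ _) eq)

lookup-σ-inverse : {σ : Vec (Fin n) n} → IsPerm σ → ∀ j → lookup σ (lookup (inverse σ) j) ≡ j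
lookup-σ-inverse {σ = σ} σ-perm j with i , σi≡j ← IsPerm⇒surjective σ-perm j =
  subst (λ i′ → lookup σ i′ ≡ j) (sym (lookup-inverse σ-perm σi≡j)) σi≡j

inverse-unique : {σ τ : Vec (Fin n) n} → IsPerm σ → (∀ j → lookup σ (lookup τ j) ≡ j) → inverse σ ≡ τ
inverse-unique σ-perm στ≗id = lookup-ext λ j → lookup-inverse σ-perm (στ≗id j)

inverse-isPerm : {σ : Vec (Fin n) n} → IsPerm σ → IsPerm (inverse σ)
inverse-isPerm {σ = σ} σ-perm = injective⇒IsPerm λ {i} {j} eq →
  trans (sym (lookup-σ-inverse σ-perm i)) (trans (cong (lookup σ) eq) (lookup-σ-inverse σ-perm j))

inverse-involutive : {σ : Vec (Fin n) n} → IsPerm σ → inverse (inverse σ) ≡ σ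
inverse-involutive σ-perm = inverse-unique (inverse-isPerm σ-perm) λ i → lookup-inverse σ-perm refl

count-inverse : (P : Vec (Fin n) n → Vec (Fin n) n → Bool) →
                count (λ σ → P σ (inverse σ)) (S n) ≡ count (λ σ → P (inverse σ) σ) (S n)
count-inverse {n} P = begin
  count (λ σ → P σ (inverse σ)) (S n)                    ≡⟨ count-↭ _ (↭-sym S⁻¹↭S) ⟩
  count (λ σ → P σ (inverse σ)) (map inverse (S n))      ≡⟨ count-map _ inverse (S n) ⟩
  count (λ σ → P (inverse σ) (inverse (inverse σ))) (S n) ≡⟨ count-cong (S n) (λ σ∈S →
                                                               cong (P _) (inverse-involutive (perm σ∈S))) ⟩
  count (λ σ → P (inverse σ) σ) (S n)                    ∎
  where
  open ≡-Reasoning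
  perm : ∀ {σ} → σ ∈ S n → IsPerm σ
  perm = Equivalence.to ∈-S
  S⁻¹↭S : map inverse (S n) ↭ S n
  S⁻¹↭S = map-involution-↭ inverse (S-unique n)
    (λ σ∈S → Equivalence.from ∈-S (inverse-isPerm (perm σ∈S)))
    (λ σ∈S → inverse-involutive (perm σ∈S))

-- Appending a last value

lookup-∷ʳ-inject₁ : (xs : Vec A m) (x : A) (i : Fin m) → lookup (xs Vec.∷ʳ x) (inject₁ i) ≡ lookup xs i
lookup-∷ʳ-inject₁ (y ∷ xs) x Fin.zero    = refl
lookup-∷ʳ-inject₁ (y ∷ xs) x (Fin.suc i) = lookup-∷ʳ-inject₁ xs x i

lookup-∷ʳ-fromℕ : (xs : Vec A m) (x : A) → lookup (xs Vec.∷ʳ x) (fromℕ m) ≡ x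
lookup-∷ʳ-fromℕ []       x = refl
lookup-∷ʳ-fromℕ (y ∷ xs) x = lookup-∷ʳ-fromℕ xs x

fromℕ-or-inject₁ : (p : Fin (suc m)) → p ≡ fromℕ m ⊎ ∃ λ i → p ≡ inject₁ i
fromℕ-or-inject₁ {zero}  Fin.zero    = inj₁ refl
fromℕ-or-inject₁ {suc m} Fin.zero    = inj₂ (Fin.zero , refl)
fromℕ-or-inject₁ {suc m} (Fin.suc p) with fromℕ-or-inject₁ p
... | inj₁ p≡m       = inj₁ (cong Fin.suc p≡m)
... | inj₂ (i , p≡i) = inj₂ (Fin.suc i , cong Fin.suc p≡i)

extend : Vec (Fin m) m → Fin (suc m) → Vec (Fin (suc m)) (suc m)
extend π x = Vec.map (punchIn x) π Vec.∷ʳ x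

lookup-extend-fromℕ : (π : Vec (Fin m) m) (x : Fin (suc m)) → lookup (extend π x) (fromℕ m) ≡ x
lookup-extend-fromℕ π x = lookup-∷ʳ-fromℕ (Vec.map (punchIn x) π) x

lookup-extend-inject₁ : (π : Vec (Fin m) m) (x : Fin (suc m)) (i : Fin m) →
                        lookup (extend π x) (inject₁ i) ≡ punchIn x (lookup π i)
lookup-extend-inject₁ π x i = trans (lookup-∷ʳ-inject₁ (Vec.map (punchIn x) π) x i) (lookup-map i (punchIn x) π)

extend-injective : {π π′ : Vec (Fin m) m} {x x′ : Fin (suc m)} → extend π x ≡ extend π′ x′ → π ≡ π′ × x ≡ x′
extend-injective {π = π} {π′} {x} eq with ∷ʳ-injective _ _ eq
... | π↑≡π′↑ , refl = lookup-ext (λ i → punchIn-injective x _ _ (begin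
  punchIn x (lookup π i)             ≡⟨ lookup-map i (punchIn x) π ⟨
  lookup (Vec.map (punchIn x) π) i   ≡⟨ cong (λ v → lookup v i) π↑≡π′↑ ⟩
  lookup (Vec.map (punchIn x) π′) i  ≡⟨ lookup-map i (punchIn x) π′ ⟩
  punchIn x (lookup π′ i)            ∎)) , refl
  where open ≡-Reasoning

extend-isPerm : {π : Vec (Fin m) m} → IsPerm π → (x : Fin (suc m)) → IsPerm (extend π x)
extend-isPerm {m} {π} π-perm x = injective⇒IsPerm λ {p} {p′} → go (fromℕ-or-inject₁ p) (fromℕ-or-inject₁ p′)
  where
  last≢inner : ∀ i → x ≢ lookup (extend π x) (inject₁ i)
  last≢inner i x≡ = punchInᵢ≢i x (lookup π i) (sym (trans x≡ (lookup-extend-inject₁ π x i)))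
  go : ∀ {p p′} → p ≡ fromℕ m ⊎ ∃ (λ i → p ≡ inject₁ i) →
                  p′ ≡ fromℕ m ⊎ ∃ (λ i → p′ ≡ inject₁ i) →
       lookup (extend π x) p ≡ lookup (extend π x) p′ → p ≡ p′
  go (inj₁ refl)       (inj₁ refl)       _  = refl
  go (inj₁ refl)       (inj₂ (i , refl)) eq = ⊥-elim (last≢inner i (trans (sym (lookup-extend-fromℕ π x)) eq))
  go (inj₂ (i , refl)) (inj₁ refl)       eq = ⊥-elim (last≢inner i (trans (sym (lookup-extend-fromℕ π x)) (sym eq)))
  go (inj₂ (i , refl)) (inj₂ (j , refl)) eq = cong inject₁ (injective π-perm (punchIn-injective x _ _
    (trans (sym (lookup-extend-inject₁ π x i)) (trans eq (lookup-extend-inject₁ π x j)))))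

-- Removing the last value x of σ and closing the gap left by x yields π with σ = extend π x.
extend-surjective : {σ : Vec (Fin (suc m)) (suc m)} → IsPerm σ → ∃₂ λ π x → IsPerm π × σ ≡ extend π x
extend-surjective {m} {σ} σ-perm with initLast σ
... | w , x , refl = π , x , injective⇒IsPerm π-injective , cong (Vec._∷ʳ x) (sym punchIn∘π≡w)
  where
  x∉w : ∀ i → x ≢ lookup w i
  x∉w i x≡wᵢ = fromℕ≢inject₁ (injective σ-perm
    (trans (lookup-∷ʳ-fromℕ w x) (trans x≡wᵢ (sym (lookup-∷ʳ-inject₁ w x i)))))
  π : Vec (Fin m) m
  π = tabulate (λ i → punchOut (x∉w i))
  punchIn∘π≡w : Vec.map (punchIn x) π ≡ w
  punchIn∘π≡w = lookup-ext λ i → trans (lookup-map i (punchIn x) π)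
    (trans (cong (punchIn x) (lookup∘tabulate _ i)) (punchIn-punchOut (x∉w i)))
  π-injective : Injective _≡_ _≡_ (lookup π)
  π-injective {i} {j} πi≡πj = inject₁-injective (injective σ-perm (begin
    lookup (w Vec.∷ʳ x) (inject₁ i) ≡⟨ lookup-∷ʳ-inject₁ w x i ⟩
    lookup w i                      ≡⟨ punchOut-injective (x∉w i) (x∉w j)
                                         (trans (sym (lookup∘tabulate _ i)) (trans πi≡πj (lookup∘tabulate _ j))) ⟩
    lookup w j                      ≡⟨ lookup-∷ʳ-inject₁ w x j ⟨
    lookup (w Vec.∷ʳ x) (inject₁ j) ∎))
    where open ≡-Reasoning

S-suc-↭ : ∀ m → S (suc m) ↭ cartesianProductWith extend (S m) (allFin (suc m))
S-suc-↭ m = unique∧set⇒↭ (S-unique (suc m))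
  (cartesianProductWith⁺ extend extend-injective (S-unique m) (allFin⁺ (suc m))) (mk⇔ to from)
  where
  to : ∀ {σ} → σ ∈ S (suc m) → σ ∈ cartesianProductWith extend (S m) (allFin (suc m))
  to σ∈S with π , x , π-perm , refl ← extend-surjective (Equivalence.to ∈-S σ∈S) =
    ∈-cartesianProductWith⁺ extend (Equivalence.from ∈-S π-perm) (∈-allFin x)
  from : ∀ {σ} → σ ∈ cartesianProductWith extend (S m) (allFin (suc m)) → σ ∈ S (suc m)
  from σ∈ with π , x , π∈S , _ , refl ← ∈-cartesianProductWith⁻ extend (S m) (allFin (suc m)) σ∈ =
    Equivalence.from ∈-S (extend-isPerm (Equivalence.to ∈-S π∈S) x)

count-S-suc : ∀ m (P : Vec (Fin (suc m)) (suc m) → Bool) →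
              count P (S (suc m)) ≡ sum (map (λ π → count (P ∘ extend π) (allFin (suc m))) (S m))
count-S-suc m P = trans (count-↭ P (S-suc-↭ m)) (count-cartesianProductWith P extend (S m) (allFin (suc m)))

length-S : ∀ m → length (S m) ≡ m !
length-S zero    = refl
length-S (suc m) = begin
  length (S (suc m))                                ≡⟨ count-true (S (suc m)) ⟨
  count (λ _ → true) (S (suc m))                    ≡⟨ count-S-suc m _ ⟩
  sum (map (λ _ → count (λ _ → true) (allFin (suc m))) (S m))
                                                    ≡⟨ sum-map-const _ (S m) (λ _ → count-allFin) ⟩
  suc m * length (S m)                              ≡⟨ cong (suc m *_) (length-S m) ⟩
  suc m * m !                                       ∎
  where
  open ≡-Reasoning
  count-allFin : count (λ _ → true) (allFin (suc m)) ≡ suc m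
  count-allFin = trans (count-true (allFin (suc m))) (length-tabulate id)

-- Major index of words

-- A descent at positions p, p + 1 (from 0) weighs o + p + 1, so majFrom 0 is maj.
majFrom : ℕ → List ℕ → ℕ
majFrom o []          = 0
majFrom o (x ∷ [])    = 0
majFrom o (x ∷ y ∷ w) = (if y <ᵇ x then suc o else 0) + majFrom (suc o) (y ∷ w)

majᴸ : List ℕ → ℕ
majᴸ = majFrom 0

<ᵇ-true : m < n → (m <ᵇ n) ≡ true
<ᵇ-true {m} {n} m<n with m <ᵇ n | <ᵇ-reflects-< m n
... | true  | _        = refl
... | false | ofⁿ m≮n = contradiction m<n m≮n

<ᵇ-false : n ≤ m → (m <ᵇ n) ≡ false
<ᵇ-false {n} {m} n≤m with m <ᵇ n | <ᵇ-reflects-< m n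
... | true  | ofʸ m<n = contradiction n≤m (<⇒≱ m<n)
... | false | _        = refl

lastExceeds : List ℕ → ℕ → Bool
lastExceeds []          a = false
lastExceeds (x ∷ [])    a = a <ᵇ x
lastExceeds (x ∷ y ∷ w) a = lastExceeds (y ∷ w) a

majFrom-∷ʳ : ∀ o w a → majFrom o (w ∷ʳ a) ≡ majFrom o w + (if lastExceeds w a then o + length w else 0)
majFrom-∷ʳ o []          a = refl
majFrom-∷ʳ o (x ∷ [])    a with a <ᵇ x
... | true  = trans (+-identityʳ (suc o)) (+-comm 1 o)
... | false = refl
majFrom-∷ʳ o (x ∷ y ∷ w) a = begin
  d + majFrom (suc o) ((y ∷ w) ∷ʳ a)                                       ≡⟨ cong (d +_) (majFrom-∷ʳ (suc o) (y ∷ w) a) ⟩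
  d + (majFrom (suc o) (y ∷ w) + (if β then suc o + length (y ∷ w) else 0)) ≡⟨ +-assoc d _ _ ⟨
  d + majFrom (suc o) (y ∷ w) + (if β then suc o + length (y ∷ w) else 0)
    ≡⟨ cong (λ l → d + majFrom (suc o) (y ∷ w) + (if β then l else 0)) (+-suc o _) ⟨
  d + majFrom (suc o) (y ∷ w) + (if β then o + length (x ∷ y ∷ w) else 0)   ∎
  where
  open ≡-Reasoning
  d = if y <ᵇ x then suc o else 0
  β = lastExceeds (y ∷ w) a

majFrom-map : (f g : A → ℕ) → (∀ x y → (f y <ᵇ f x) ≡ (g y <ᵇ g x)) →
              ∀ o xs → majFrom o (map f xs) ≡ majFrom o (map g xs)
majFrom-map f g f∼g o []          = refl
majFrom-map f g f∼g o (x ∷ [])    = refl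
majFrom-map f g f∼g o (x ∷ y ∷ w) =
  cong₂ _+_ (cong (λ β → if β then suc o else 0) (f∼g x y)) (majFrom-map f g f∼g (suc o) (y ∷ w))

lastExceeds-∷ʳ : ∀ w {a z} → a < z → lastExceeds (w ∷ʳ z) a ≡ true
lastExceeds-∷ʳ []          a<z = <ᵇ-true a<z
lastExceeds-∷ʳ (x ∷ [])    a<z = <ᵇ-true a<z
lastExceeds-∷ʳ (x ∷ y ∷ w) a<z = lastExceeds-∷ʳ (y ∷ w) a<z

lastExceeds-All : ∀ {w z} → All (_< z) w → lastExceeds w z ≡ false
lastExceeds-All []                  = refl
lastExceeds-All (x<z ∷ [])          = <ᵇ-false (<⇒≤ x<z)
lastExceeds-All (_ ∷ y<z ∷ w<z)     = lastExceeds-All (y<z ∷ w<z)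

majᴸ-∷ʳ-max : ∀ {w z} → All (_< z) w → majᴸ (w ∷ʳ z) ≡ majᴸ w
majᴸ-∷ʳ-max {w} {z} w<z = begin
  majᴸ (w ∷ʳ z)                                      ≡⟨ majFrom-∷ʳ 0 w z ⟩
  majᴸ w + (if lastExceeds w z then length w else 0)
    ≡⟨ cong (λ β → majᴸ w + (if β then length w else 0)) (lastExceeds-All w<z) ⟩
  majᴸ w + 0                                         ≡⟨ +-identityʳ _ ⟩
  majᴸ w                                             ∎
  where open ≡-Reasoning

insert : ℕ → ℕ → List ℕ → List ℕ
insert zero    z w       = z ∷ w
insert (suc s) z []      = z ∷ []
insert (suc s) z (x ∷ w) = x ∷ insert s z w

insert-≥ : ∀ {s z} w → length w ≤ s → insert s z w ≡ w ∷ʳ z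
insert-≥ {zero}  []      _         = refl
insert-≥ {suc s} []      _         = refl
insert-≥ {suc s} (x ∷ w) (s≤s w≤s) = cong (x ∷_) (insert-≥ w w≤s)

insert-∷ʳ : ∀ {s z} w a → s ≤ length w → insert s z (w ∷ʳ a) ≡ insert s z w ∷ʳ a
insert-∷ʳ {zero}  w       a _         = refl
insert-∷ʳ {suc s} (x ∷ w) a (s≤s s≤w) = cong (x ∷_) (insert-∷ʳ w a s≤w)

length-insert : ∀ {s z} w → s ≤ length w → length (insert s z w) ≡ suc (length w)
length-insert {zero}  w       _         = refl
length-insert {suc s} (x ∷ w) (s≤s s≤w) = cong suc (length-insert w s≤w)

lastExceeds-insert : ∀ {s z} w a → s < length w → lastExceeds (insert s z w) a ≡ lastExceeds w a
lastExceeds-insert {zero}  (x ∷ [])    a _         = refl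
lastExceeds-insert {zero}  (x ∷ y ∷ w) a _         = refl
lastExceeds-insert {suc s} (x ∷ y ∷ w) a (s≤s s<w) =
  trans (drop-head (insert-nonempty s)) (lastExceeds-insert (y ∷ w) a s<w)
  where
  insert-nonempty : ∀ s {z} → ∃₂ λ v vs → insert s z (y ∷ w) ≡ v ∷ vs
  insert-nonempty zero    = _ , _ , refl
  insert-nonempty (suc s) = _ , _ , refl
  drop-head : ∀ {ys} → ∃₂ (λ v vs → ys ≡ v ∷ vs) → lastExceeds (x ∷ ys) a ≡ lastExceeds ys a
  drop-head (_ , _ , refl) = refl

length-∷ʳ : (w : List A) (a : A) → length (w ∷ʳ a) ≡ suc (length w)
length-∷ʳ w a = trans (length-++ w) (+-comm (length w) 1)

range : ℕ → ℕ → List ℕ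
range a zero    = []
range a (suc N) = a ∷ range (suc a) N

range-∷ʳ : ∀ a N → range a (suc N) ≡ range a N ∷ʳ (a + N)
range-∷ʳ a zero    = cong [_] (sym (+-identityʳ a))
range-∷ʳ a (suc N) = cong (a ∷_) (trans (range-∷ʳ (suc a) N) (cong (range (suc a) N ∷ʳ_) (sym (+-suc a N))))

range-++ : ∀ a N K → range a (N + K) ≡ range a N ++ range (a + N) K
range-++ a zero    K = cong (λ b → range b K) (sym (+-identityʳ a))
range-++ a (suc N) K =
  cong (a ∷_) (trans (range-++ (suc a) N K) (cong (λ b → range (suc a) N ++ range b K) (sym (+-suc a N))))

map-+-range : ∀ e a N → map (_+ e) (range a N) ≡ range (a + e) N
map-+-range e a zero    = refl
map-+-range e a (suc N) = cong (a + e ∷_) (map-+-range e (suc a) N)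

∈-range⇒< : ∀ {s} a N → s ∈ range a N → s < a + N
∈-range⇒< a (suc N) (here refl) = m<m+n a (s≤s z≤n)
∈-range⇒< {s} a (suc N) (there s∈) = subst (s <_) (sym (+-suc a N)) (∈-range⇒< (suc a) N s∈)

range-rotate : ∀ c t β →
  range (suc c + (if β then suc t else 0)) t ∷ʳ (c + suc t) ∷ʳ (c + (if β then t else 0))
    ↭ range (c + (if β then t else 0)) (suc (suc t))
range-rotate c t false rewrite +-identityʳ c = begin
  range (suc c) t ∷ʳ (c + suc t) ∷ʳ c
    ↭⟨ ∷↭∷ʳ c _ ⟨
  c ∷ (range (suc c) t ∷ʳ (c + suc t))
    ≡⟨ cong (c ∷_) (trans (cong (range (suc c) t ∷ʳ_) (+-suc c t)) (sym (range-∷ʳ (suc c) t))) ⟩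
  c ∷ range (suc c) (suc t)
    ∎
  where open PermutationReasoning
range-rotate c t true rewrite +-suc c t = begin
  range (suc (suc (c + t))) t ∷ʳ suc (c + t) ∷ʳ (c + t)   ↭⟨ ∷↭∷ʳ (c + t) _ ⟨
  c + t ∷ (range (suc (suc (c + t))) t ∷ʳ suc (c + t))    ↭⟨ ↭-prep (c + t) (∷↭∷ʳ (suc (c + t)) _) ⟨
  c + t ∷ suc (c + t) ∷ range (suc (suc (c + t))) t       ∎
  where open PermutationReasoning

majᴸ-insert-end : ∀ {s z} w → length w ≤ s → All (_< z) w → majᴸ (insert s z w) ≡ majᴸ w
majᴸ-insert-end w w≤s w<z = trans (cong majᴸ (insert-≥ w w≤s)) (majᴸ-∷ʳ-max w<z)

majᴸ-insert-inner : ∀ {s z} u a → s < length u →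
                    majᴸ (insert s z (u ∷ʳ a)) ≡ majᴸ (insert s z u) + (if lastExceeds u a then suc (length u) else 0)
majᴸ-insert-inner {s} {z} u a s<u = begin
  majᴸ (insert s z (u ∷ʳ a))
    ≡⟨ cong majᴸ (insert-∷ʳ u a (<⇒≤ s<u)) ⟩
  majᴸ (insert s z u ∷ʳ a)
    ≡⟨ majFrom-∷ʳ 0 (insert s z u) a ⟩
  majᴸ (insert s z u) + (if lastExceeds (insert s z u) a then length (insert s z u) else 0)
    ≡⟨ cong₂ (λ β l → majᴸ (insert s z u) + (if β then l else 0))
             (lastExceeds-insert u a s<u) (length-insert u (<⇒≤ s<u)) ⟩
  majᴸ (insert s z u) + (if lastExceeds u a then suc (length u) else 0)
    ∎
  where open ≡-Reasoning

majᴸ-insert-penultimate : ∀ {z} u a → All (_< z) u → a < z →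
                          majᴸ (insert (length u) z (u ∷ʳ a)) ≡ majᴸ u + suc (length u)
majᴸ-insert-penultimate {z} u a u<z a<z = begin
  majᴸ (insert (length u) z (u ∷ʳ a))
    ≡⟨ cong majᴸ (trans (insert-∷ʳ u a ≤-refl) (cong (_∷ʳ a) (insert-≥ u ≤-refl))) ⟩
  majᴸ (u ∷ʳ z ∷ʳ a)
    ≡⟨ majFrom-∷ʳ 0 (u ∷ʳ z) a ⟩
  majᴸ (u ∷ʳ z) + (if lastExceeds (u ∷ʳ z) a then length (u ∷ʳ z) else 0)
    ≡⟨ cong₂ (λ m β → m + (if β then length (u ∷ʳ z) else 0)) (majᴸ-∷ʳ-max u<z) (lastExceeds-∷ʳ u a<z) ⟩
  majᴸ u + length (u ∷ʳ z)
    ≡⟨ cong (majᴸ u +_) (length-∷ʳ u z) ⟩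
  majᴸ u + suc (length u)
    ∎
  where open ≡-Reasoning

InsertionSpread : ℕ → List ℕ → Set
InsertionSpread z w = map (λ s → majᴸ (insert s z w)) (range 0 (suc (length w))) ↭ range (majᴸ w) (suc (length w))

insertionSpread-init : ∀ {z} u → All (_< z) u → InsertionSpread z u →
                       map (λ s → majᴸ (insert s z u)) (range 0 (length u)) ↭ range (suc (majᴸ u)) (length u)
insertionSpread-init {z} u u<z spread = drop-∷ (begin
  majᴸ u ∷ map G (range 0 (length u))         ↭⟨ ∷↭∷ʳ (majᴸ u) _ ⟩
  map G (range 0 (length u)) ∷ʳ majᴸ u
    ≡⟨ cong (map G (range 0 (length u)) ∷ʳ_) (majᴸ-insert-end u ≤-refl u<z) ⟨
  map G (range 0 (length u)) ∷ʳ G (length u)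
    ≡⟨ trans (cong (map G) (range-∷ʳ 0 (length u))) (map-++ G (range 0 (length u)) _) ⟨
  map G (range 0 (suc (length u)))            ↭⟨ spread ⟩
  majᴸ u ∷ range (suc (majᴸ u)) (length u)    ∎)
  where
  open PermutationReasoning
  G : ℕ → ℕ
  G s = majᴸ (insert s z u)

-- At a slot s < |u|, inserting z moves the possible descent at a one place right, so all values
-- for u are raised by the same amount; the slots |u| and |u| + 1 supply the two remaining values.
insertionSpread-∷ʳ : ∀ {z} u a → All (_< z) (u ∷ʳ a) → InsertionSpread z u → InsertionSpread z (u ∷ʳ a)
insertionSpread-∷ʳ {z} u a u∷ʳa<z spread = begin
  map F (range 0 (suc (length (u ∷ʳ a))))
    ≡⟨ cong (λ N → map F (range 0 (suc N))) (length-∷ʳ u a) ⟩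
  map F (range 0 (suc (suc t)))
    ≡⟨ cong (map F) (trans (range-∷ʳ 0 (suc t)) (cong (_∷ʳ suc t) (range-∷ʳ 0 t))) ⟩
  map F (range 0 t ∷ʳ t ∷ʳ suc t)
    ≡⟨ trans (map-++ F (range 0 t ∷ʳ t) _) (cong (_∷ʳ F (suc t)) (map-++ F (range 0 t) _)) ⟩
  map F (range 0 t) ∷ʳ F t ∷ʳ F (suc t)
    ≡⟨ cong₂ (λ p q → map F (range 0 t) ∷ʳ p ∷ʳ q) (majᴸ-insert-penultimate u a u<z a<z) F-last ⟩
  map F (range 0 t) ∷ʳ (c + suc t) ∷ʳ (c + e′)
    ↭⟨ ++⁺ʳ _ (++⁺ʳ _ F-init) ⟩
  range (suc c + e) t ∷ʳ (c + suc t) ∷ʳ (c + e′)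
    ↭⟨ range-rotate c t β ⟩
  range (c + e′) (suc (suc t))
    ≡⟨ cong₂ (λ b N → range b (suc N)) (majFrom-∷ʳ 0 u a) (length-∷ʳ u a) ⟨
  range (majᴸ (u ∷ʳ a)) (suc (length (u ∷ʳ a)))
    ∎
  where
  open PermutationReasoning
  t = length u
  c = majᴸ u
  β = lastExceeds u a
  e = if β then suc t else 0
  e′ = if β then t else 0
  u<z : All (_< z) u
  u<z = ++⁻ˡ u u∷ʳa<z
  a<z : a < z
  a<z with a<z ∷ [] ← ++⁻ʳ u u∷ʳa<z = a<z
  F : ℕ → ℕ
  F s = majᴸ (insert s z (u ∷ʳ a))
  F-last : F (suc t) ≡ c + e′
  F-last = trans (majᴸ-insert-end (u ∷ʳ a) (≤-reflexive (length-∷ʳ u a)) u∷ʳa<z) (majFrom-∷ʳ 0 u a)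
  F-init : map F (range 0 t) ↭ range (suc c + e) t
  F-init = begin
    map F (range 0 t)
      ≡⟨ map-cong-local (All.tabulate λ s∈ → majᴸ-insert-inner u a (∈-range⇒< 0 t s∈)) ⟩
    map ((_+ e) ∘ (λ s → majᴸ (insert s z u))) (range 0 t)
      ≡⟨ map-∘ (range 0 t) ⟩
    map (_+ e) (map (λ s → majᴸ (insert s z u)) (range 0 t))
      ↭⟨ ↭-map⁺ (_+ e) (insertionSpread-init u u<z spread) ⟩
    map (_+ e) (range (suc c) t)
      ≡⟨ map-+-range e (suc c) t ⟩
    range (suc c + e) t
      ∎

insertionSpread : ∀ {z} w → All (_< z) w → InsertionSpread z w
insertionSpread w = go (reverseView w)
  where
  go : ∀ {z w} → Reverse w → All (_< z) w → InsertionSpread z w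
  go []              _      = ↭-refl
  go (u ∶ rs ∶ʳ a) u∷ʳa<z = insertionSpread-∷ʳ u a u∷ʳa<z (go rs (++⁻ˡ u u∷ʳa<z))

-- Residues of consecutive integers

≡ᵇ-reflects-≡ : ∀ m n → Reflects (m ≡ n) (m ≡ᵇ n)
≡ᵇ-reflects-≡ m n = fromEquivalence (≡ᵇ⇒≡ m n) (≡⇒≡ᵇ m n)

count-≡ᵇ-range-below : ∀ {i} a N → i < a → count (_≡ᵇ i) (range a N) ≡ 0
count-≡ᵇ-range-below     a zero    i<a = refl
count-≡ᵇ-range-below {i} a (suc N) i<a with a ≡ᵇ i | ≡ᵇ-reflects-≡ a i
... | true  | ofʸ refl = contradiction i<a (<-irrefl refl)
... | false | _        = count-≡ᵇ-range-below (suc a) N (m<n⇒m<1+n i<a)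

count-≡ᵇ-range : ∀ {i} a N → a ≤ i → i < a + N → count (_≡ᵇ i) (range a N) ≡ 1
count-≡ᵇ-range {i} a zero    a≤i i<a+0 = contradiction a≤i (<⇒≱ (subst (i <_) (+-identityʳ a) i<a+0))
count-≡ᵇ-range {i} a (suc N) a≤i i<a+N with a ≡ᵇ i | ≡ᵇ-reflects-≡ a i
... | true  | ofʸ refl = cong suc (count-≡ᵇ-range-below (suc a) N (n<1+n a))
... | false | ofⁿ a≢i = count-≡ᵇ-range (suc a) N (≤∧≢⇒< a≤i a≢i) (subst (i <_) (+-suc a N) i<a+N)

count-singleton : (P : A → Bool) (x : A) → count P [ x ] ≡ (if P x then 1 else 0)
count-singleton P x with P x
... | true  = refl
... | false = refl

count-%-range-window : ∀ {k i} .{{_ : NonZero k}} c → i < k → count (λ r → r % k ≡ᵇ i) (range c k) ≡ 1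
count-%-range-window {k} {i} zero i<k =
  trans (count-cong (range 0 k) (λ r∈ → cong (_≡ᵇ i) (m<n⇒m%n≡m (∈-range⇒< 0 k r∈)))) (count-≡ᵇ-range 0 k z≤n i<k)
count-%-range-window {suc k′} {i} (suc c) i<k = begin
  count P (range (suc c) (suc k′))                    ≡⟨ cong (count P) (range-∷ʳ (suc c) k′) ⟩
  count P (range (suc c) k′ ∷ʳ (suc c + k′))          ≡⟨ count-++ P (range (suc c) k′) _ ⟩
  count P (range (suc c) k′) + count P [ suc c + k′ ] ≡⟨ cong (count P (range (suc c) k′) +_) same-residue ⟩
  count P (range (suc c) k′) + count P [ c ]          ≡⟨ +-comm (count P (range (suc c) k′)) _ ⟩
  count P [ c ] + count P (range (suc c) k′)          ≡⟨ count-++ P [ c ] _ ⟨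
  count P (range c (suc k′))                          ≡⟨ count-%-range-window c i<k ⟩
  1                                                   ∎
  where
  open ≡-Reasoning
  P : ℕ → Bool
  P r = r % suc k′ ≡ᵇ i
  same-residue : count P [ suc c + k′ ] ≡ count P [ c ]
  same-residue = trans (count-singleton P (suc c + k′)) (trans (cong (λ r → if r ≡ᵇ i then 1 else 0)
    (trans (cong (_% suc k′) (sym (+-suc c k′))) ([m+n]%n≡m%n c (suc k′)))) (sym (count-singleton P c)))

count-%-range : ∀ {k i} .{{_ : NonZero k}} c q → i < k → count (λ r → r % k ≡ᵇ i) (range c (q * k)) ≡ q
count-%-range         c zero    i<k = refl
count-%-range {k} {i} c (suc q) i<k =
  trans (cong (count P) (range-++ c k (q * k)))
        (trans (count-++ P (range c k) _) (cong₂ _+_ (count-%-range-window c i<k) (count-%-range (c + k) q i<k)))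
  where
  P : ℕ → Bool
  P r = r % k ≡ᵇ i

word : Vec (Fin n) m → List ℕ
word v = toList (Vec.map toℕ v)

length-word : (v : Vec (Fin n) m) → length (word v) ≡ m
length-word v = length-toList (Vec.map toℕ v)

word-< : (v : Vec (Fin n) m) → All (_< n) (word v)
word-< []      = []
word-< (x ∷ v) = toℕ<n x ∷ word-< v

word-map : (f : Fin m → Fin n) (v : Vec (Fin m) m) → word (Vec.map f v) ≡ map (toℕ ∘ f) (toList v)
word-map f v = trans (cong toList (sym (vmap-∘ toℕ f v))) (toList-map (toℕ ∘ f) v)

word-inject₁ : (v : Vec (Fin n) m) → word (Vec.map inject₁ v) ≡ word v
word-inject₁ []      = refl
word-inject₁ (x ∷ v) = cong₂ _∷_ (toℕ-inject₁ x) (word-inject₁ v)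

word-insertAt : (v : Vec (Fin n) m) (x : Fin (suc m)) (z : Fin n) →
                word (insertAt v x z) ≡ insert (toℕ x) (toℕ z) (word v)
word-insertAt v       Fin.zero    z = refl
word-insertAt (y ∷ v) (Fin.suc x) z = cong (toℕ y ∷_) (word-insertAt v x z)

descentWeight : ∀ {m} → ℕ → Vec ℕ (suc m) → Fin m → ℕ
descentWeight o w p = if lookup w (Fin.suc p) <ᵇ lookup w (inject₁ p) then o + suc (toℕ p) else 0

sum-descentWeight : ∀ m o (w : Vec ℕ (suc m)) → sum (tabulateᴸ (descentWeight o w)) ≡ majFrom o (toList w)
sum-descentWeight zero    o (x ∷ [])    = refl
sum-descentWeight (suc m) o (x ∷ y ∷ w) =
  cong₂ _+_ (cong (λ d → if y <ᵇ x then d else 0) (+-comm o 1))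
    (trans (cong sum (tabulateᴸ-cong λ p →
              cong (λ d → if lookup (y ∷ w) (Fin.suc p) <ᵇ lookup (y ∷ w) (inject₁ p) then d else 0)
                   (+-suc o (suc (toℕ p)))))
           (sum-descentWeight m (suc o) (y ∷ w)))

maj≡majᴸ-word : (σ : Vec (Fin n) n) → maj σ ≡ majᴸ (word σ)
maj≡majᴸ-word {zero}  []  = refl
maj≡majᴸ-word {suc m} σ = trans
  (cong sum (trans (map-tabulate id _) (tabulateᴸ-cong λ p →
    cong₂ (λ x y → if x <ᵇ y then suc (toℕ p) else 0)
          (sym (lookup-map (Fin.suc p) toℕ σ)) (sym (lookup-map (inject₁ p) toℕ σ)))))
  (sum-descentWeight m 0 (Vec.map toℕ σ))

punchIn-<ᵇ : (x : Fin (suc m)) (i j : Fin m) → (toℕ (punchIn x j) <ᵇ toℕ (punchIn x i)) ≡ (toℕ j <ᵇ toℕ i)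
punchIn-<ᵇ x i j
  with toℕ (punchIn x j) <ᵇ toℕ (punchIn x i) | <ᵇ-reflects-< (toℕ (punchIn x j)) (toℕ (punchIn x i))
     | toℕ j <ᵇ toℕ i | <ᵇ-reflects-< (toℕ j) (toℕ i)
... | true  | _          | true  | _        = refl
... | false | _          | false | _        = refl
... | true  | ofʸ ↑j<↑i  | false | ofⁿ j≮i =
  contradiction (≰⇒> λ i≤j → <⇒≱ ↑j<↑i (punchIn-mono-≤ x i j i≤j)) j≮i
... | false | ofⁿ ↑j≮↑i | true  | ofʸ j<i =
  contradiction (≰⇒> λ ↑i≤↑j → <⇒≱ j<i (punchIn-cancel-≤ x i j ↑i≤↑j)) ↑j≮↑i

maj-extend : (π : Vec (Fin m) m) (x : Fin (suc m)) → maj (extend π x) ≡ maj π ⊎ maj (extend π x) ≡ maj π + m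
maj-extend {m} π x = cases β (begin
  maj (extend π x)                                         ≡⟨ maj≡majᴸ-word (extend π x) ⟩
  majᴸ (word (extend π x))                                 ≡⟨ cong majᴸ word-extend ⟩
  majᴸ (word π↑ ∷ʳ toℕ x)                                  ≡⟨ majFrom-∷ʳ 0 (word π↑) (toℕ x) ⟩
  majᴸ (word π↑) + (if β then length (word π↑) else 0)
    ≡⟨ cong₂ (λ M l → M + (if β then l else 0)) majᴸ-word-π↑ (length-word π↑) ⟩
  maj π + (if β then m else 0)                             ∎)
  where
  open ≡-Reasoning
  π↑ = Vec.map (punchIn x) π
  β = lastExceeds (word π↑) (toℕ x)
  word-extend : word (extend π x) ≡ word π↑ ∷ʳ toℕ x
  word-extend = trans (cong toList (map-∷ʳ toℕ x π↑)) (toList-∷ʳ (toℕ x) (Vec.map toℕ π↑))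
  majᴸ-word-π↑ : majᴸ (word π↑) ≡ maj π
  majᴸ-word-π↑ = begin
    majᴸ (word π↑)                          ≡⟨ cong majᴸ (word-map (punchIn x) π) ⟩
    majᴸ (map (toℕ ∘ punchIn x) (toList π)) ≡⟨ majFrom-map (toℕ ∘ punchIn x) toℕ (punchIn-<ᵇ x) 0 (toList π) ⟩
    majᴸ (map toℕ (toList π))               ≡⟨ cong majᴸ (toList-map toℕ π) ⟨
    majᴸ (word π)                           ≡⟨ maj≡majᴸ-word π ⟨
    maj π                                   ∎
  cases : ∀ {M} β → M ≡ maj π + (if β then m else 0) → M ≡ maj π ⊎ M ≡ maj π + m
  cases true  M≡ = inj₂ M≡
  cases false M≡ = inj₁ (trans M≡ (+-identityʳ (maj π)))

maj-extend-% : ∀ {ℓ q} .{{_ : NonZero ℓ}} (π : Vec (Fin m) m) (x : Fin (suc m)) → m ≡ q * ℓ →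
               maj (extend π x) % ℓ ≡ maj π % ℓ
maj-extend-% {m} {ℓ} {q} π x m≡qℓ with maj-extend π x
... | inj₁ unchanged = cong (_% ℓ) unchanged
... | inj₂ raised    = trans (cong (_% ℓ) (trans raised (cong (maj π +_) m≡qℓ))) ([m+kn]%n≡m%n (maj π) q ℓ)

inverse-extend : {π : Vec (Fin m) m} → IsPerm π → (x : Fin (suc m)) →
                 inverse (extend π x) ≡ insertAt (Vec.map inject₁ (inverse π)) x (fromℕ m)
inverse-extend {m} {π} π-perm x = inverse-unique (extend-isPerm π-perm x) section
  where
  τ = insertAt (Vec.map inject₁ (inverse π)) x (fromℕ m)
  section : ∀ y → lookup (extend π x) (lookup τ y) ≡ y
  section y with x ≟ᶠ y
  ... | yes refl = trans (cong (lookup (extend π x)) (insertAt-lookup _ x (fromℕ m))) (lookup-extend-fromℕ π x)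
  ... | no x≢y = subst (λ y → lookup (extend π x) (lookup τ y) ≡ y) (punchIn-punchOut x≢y) (begin
    lookup (extend π x) (lookup τ (punchIn x y′))
      ≡⟨ cong (lookup (extend π x)) (trans (insertAt-punchIn _ x (fromℕ m) y′) (lookup-map y′ inject₁ (inverse π))) ⟩
    lookup (extend π x) (inject₁ (lookup (inverse π) y′))  ≡⟨ lookup-extend-inject₁ π x _ ⟩
    punchIn x (lookup π (lookup (inverse π) y′))           ≡⟨ cong (punchIn x) (lookup-σ-inverse π-perm y′) ⟩
    punchIn x y′                                           ∎)
    where
    open ≡-Reasoning
    y′ = punchOut x≢y

maj-inverse-extend : {π : Vec (Fin m) m} → IsPerm π → (x : Fin (suc m)) →
                     maj (inverse (extend π x)) ≡ majᴸ (insert (toℕ x) m (word (inverse π)))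
maj-inverse-extend {m} {π} π-perm x = trans (maj≡majᴸ-word (inverse (extend π x))) (cong majᴸ (begin
  word (inverse (extend π x))                                         ≡⟨ cong word (inverse-extend π-perm x) ⟩
  word (insertAt (Vec.map inject₁ (inverse π)) x (fromℕ m))           ≡⟨ word-insertAt _ x (fromℕ m) ⟩
  insert (toℕ x) (toℕ (fromℕ m)) (word (Vec.map inject₁ (inverse π)))
    ≡⟨ cong₂ (insert (toℕ x)) (toℕ-fromℕ m) (word-inject₁ (inverse π)) ⟩
  insert (toℕ x) m (word (inverse π))                                 ∎))
  where open ≡-Reasoning

tabulate-range : ∀ n c (f : Fin n → ℕ) → (∀ i → f i ≡ c + toℕ i) → tabulateᴸ f ≡ range c n
tabulate-range zero    c f f≗ = refl
tabulate-range (suc n) c f f≗ =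
  cong₂ _∷_ (trans (f≗ Fin.zero) (+-identityʳ c))
            (tabulate-range n (suc c) (f ∘ Fin.suc) λ i → trans (f≗ (Fin.suc i)) (+-suc c (toℕ i)))

map-toℕ-allFin : ∀ n → map toℕ (allFin n) ≡ range 0 n
map-toℕ-allFin n = trans (map-tabulate id toℕ) (tabulate-range n 0 toℕ (λ _ → refl))

-- Counting permutations by maj

count-maj-inverse-extend : ∀ {k q i} .{{_ : NonZero k}} {π : Vec (Fin m) m} → IsPerm π → suc m ≡ q * k → i < k →
                           count (λ x → maj (inverse (extend π x)) % k ≡ᵇ i) (allFin (suc m)) ≡ q
count-maj-inverse-extend {m} {k} {q} {i} {π} π-perm m+1≡qk i<k = begin
  count (λ x → maj (inverse (extend π x)) % k ≡ᵇ i) (allFin (suc m))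
    ≡⟨ count-cong (allFin (suc m)) (λ {x} _ → cong (λ r → r % k ≡ᵇ i) (maj-inverse-extend π-perm x)) ⟩
  count (residue ∘ insertionMaj ∘ toℕ) (allFin (suc m))
    ≡⟨ count-map (residue ∘ insertionMaj) toℕ (allFin (suc m)) ⟨
  count (residue ∘ insertionMaj) (map toℕ (allFin (suc m)))
    ≡⟨ cong (count (residue ∘ insertionMaj)) (map-toℕ-allFin (suc m)) ⟩
  count (residue ∘ insertionMaj) (range 0 (suc m))    ≡⟨ count-map residue insertionMaj (range 0 (suc m)) ⟨
  count residue (map insertionMaj (range 0 (suc m)))  ≡⟨ count-↭ residue spread ⟩
  count residue (range (majᴸ w) (suc m))              ≡⟨ cong (count residue ∘ range (majᴸ w)) m+1≡qk ⟩
  count residue (range (majᴸ w) (q * k))              ≡⟨ count-%-range (majᴸ w) q i<k ⟩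
  q                                                   ∎
  where
  open ≡-Reasoning
  w : List ℕ
  w = word (inverse π)
  insertionMaj : ℕ → ℕ
  insertionMaj s = majᴸ (insert s m w)
  residue : ℕ → Bool
  residue r = r % k ≡ᵇ i
  spread : map insertionMaj (range 0 (suc m)) ↭ range (majᴸ w) (suc m)
  spread = subst (λ N → map insertionMaj (range 0 (suc N)) ↭ range (majᴸ w) (suc N))
                 (length-word (inverse π)) (insertionSpread w (word-< (inverse π)))

count-maj : ∀ {ℓ q j} .{{_ : NonZero ℓ}} m → suc m ≡ q * ℓ → j < ℓ →
            count (λ π → maj π % ℓ ≡ᵇ j) (S (suc m)) ≡ q * m !
count-maj {ℓ} {q} {j} m m+1≡qℓ j<ℓ = begin
  count (λ π → maj π % ℓ ≡ᵇ j) (S (suc m))            ≡⟨ count-inverse {n = suc m} (λ π _ → maj π % ℓ ≡ᵇ j) ⟩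
  count (λ π → maj (inverse π) % ℓ ≡ᵇ j) (S (suc m))  ≡⟨ count-S-suc m _ ⟩
  sum (map (λ ρ → count (λ x → maj (inverse (extend ρ x)) % ℓ ≡ᵇ j) (allFin (suc m))) (S m))
    ≡⟨ sum-map-const _ (S m) (λ ρ∈S → count-maj-inverse-extend {q = q} (Equivalence.to ∈-S ρ∈S) m+1≡qℓ j<ℓ) ⟩
  q * length (S m)                                    ≡⟨ cong (q *_) (length-S m) ⟩
  q * m !                                             ∎
  where open ≡-Reasoning

count-maj-maj-inverse : ∀ {k ℓ q₁ q₂ i j} .{{_ : NonZero k}} .{{_ : NonZero ℓ}} m →
  suc (suc m) ≡ q₁ * k → suc m ≡ q₂ * ℓ → i < k → j < ℓ →
  count (λ σ → (maj σ % k ≡ᵇ i) ∧ (maj (inverse σ) % ℓ ≡ᵇ j)) (S (suc (suc m))) ≡ q₁ * (q₂ * m !)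
count-maj-maj-inverse {k} {ℓ} {q₁} {q₂} {i} {j} m n≡q₁k n-1≡q₂ℓ i<k j<ℓ = begin
  count (λ σ → (maj σ % k ≡ᵇ i) ∧ (maj (inverse σ) % ℓ ≡ᵇ j)) (S (suc (suc m)))
    ≡⟨ count-inverse {n = suc (suc m)} (λ σ τ → (maj σ % k ≡ᵇ i) ∧ (maj τ % ℓ ≡ᵇ j)) ⟩
  count (λ σ → (maj (inverse σ) % k ≡ᵇ i) ∧ (maj σ % ℓ ≡ᵇ j)) (S (suc (suc m)))
    ≡⟨ count-S-suc (suc m) _ ⟩
  sum (map (λ π → count (λ x → inverseHit π x ∧ (maj (extend π x) % ℓ ≡ᵇ j)) (allFin (suc (suc m)))) (S (suc m)))
    ≡⟨ cong sum (map-cong-local (All.tabulate fibre)) ⟩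
  sum (map (λ π → if maj π % ℓ ≡ᵇ j then q₁ else 0) (S (suc m)))
    ≡⟨ sum-map-if _ q₁ (S (suc m)) ⟩
  q₁ * count (λ π → maj π % ℓ ≡ᵇ j) (S (suc m))
    ≡⟨ cong (q₁ *_) (count-maj {q = q₂} m n-1≡q₂ℓ j<ℓ) ⟩
  q₁ * (q₂ * m !)
    ∎
  where
  open ≡-Reasoning
  inverseHit : Vec (Fin (suc m)) (suc m) → Fin (suc (suc m)) → Bool
  inverseHit π x = maj (inverse (extend π x)) % k ≡ᵇ i
  fibre : ∀ {π} → π ∈ S (suc m) →
          count (λ x → inverseHit π x ∧ (maj (extend π x) % ℓ ≡ᵇ j)) (allFin (suc (suc m)))
            ≡ (if maj π % ℓ ≡ᵇ j then q₁ else 0)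
  fibre {π} π∈S = begin
    count (λ x → inverseHit π x ∧ (maj (extend π x) % ℓ ≡ᵇ j)) (allFin (suc (suc m)))
      ≡⟨ count-cong (allFin (suc (suc m))) (λ {x} _ →
           cong (λ r → inverseHit π x ∧ (r ≡ᵇ j)) (maj-extend-% {q = q₂} π x n-1≡q₂ℓ)) ⟩
    count (λ x → inverseHit π x ∧ (maj π % ℓ ≡ᵇ j)) (allFin (suc (suc m)))
      ≡⟨ count-∧-const (inverseHit π) (maj π % ℓ ≡ᵇ j) (allFin (suc (suc m))) ⟩
    (if maj π % ℓ ≡ᵇ j then count (inverseHit π) (allFin (suc (suc m))) else 0)
      ≡⟨ cong (λ c → if maj π % ℓ ≡ᵇ j then c else 0)
              (count-maj-inverse-extend {q = q₁} (Equivalence.to ∈-S π∈S) n≡q₁k i<k) ⟩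
    (if maj π % ℓ ≡ᵇ j then q₁ else 0)
      ∎

theorem3p1 : (n ℓ k i j : ℕ) → 2 ≤ n →
    .{{_ : NonZero ℓ}} → ℓ ∣ n ∸ 1 → ℓ ≢ 1 →
    .{{_ : NonZero k}} → k ∣ n → k ≢ 1 →
    i < k → j < ℓ →
    length (filterᵇ (λ σ → ((maj σ % k) ≡ᵇ i) ∧ ((maj (inverse σ) % ℓ) ≡ᵇ j)) (S n))
      * (k * ℓ) ≡ n !
theorem3p1 zero          _ _ _ _ ()
theorem3p1 (suc zero)    _ _ _ _ (s≤s ())
theorem3p1 (suc (suc m)) ℓ k i j _ (divides q₂ n-1≡q₂ℓ) _ (divides q₁ n≡q₁k) _ i<k j<ℓ = begin
  count (λ σ → (maj σ % k ≡ᵇ i) ∧ (maj (inverse σ) % ℓ ≡ᵇ j)) (S (suc (suc m))) * (k * ℓ)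
    ≡⟨ cong (_* (k * ℓ)) (count-maj-maj-inverse {q₁ = q₁} {q₂} m n≡q₁k n-1≡q₂ℓ i<k j<ℓ) ⟩
  q₁ * (q₂ * m !) * (k * ℓ)            ≡⟨ regroup q₁ q₂ (m !) k ℓ ⟩
  q₁ * k * (q₂ * ℓ * m !)              ≡⟨ cong₂ (λ a b → a * (b * m !)) n≡q₁k n-1≡q₂ℓ ⟨
  suc (suc m) ! ∎
  where
  open ≡-Reasoning
  regroup : ∀ a b c d e → a * (b * c) * (d * e) ≡ a * d * (b * e * c)
  regroup = solve-∀
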